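{- Let $N\ge1$ and $D^{(1)}=(\mathbb{Z}/N\mathbb{Z})^2$ with quadratic form $Q(x,y)=xy/N\bmod\mathbb{Z}$. For each divisor $d$ of $N$ let $H_d=\{(x,y)\in D^{(1)}: d\mid x,\ (N/d)\mid y\}$ and $v^{H_d}=\sum_{\gamma\in H_d}\mathfrak{e}_\gamma\in\mathbb{C}[D^{(1)}]$. Then the vectors $v^{H_d}$, $d\mid N$, form a basis of the space $\mathcal{M}_{0,D^{(1)}}$ of holomorphic modular forms of weight $0$ for the Weil representation $\varrho_{D^{(1)}}$, i.e. of the space of vectors in $\mathbb{C}[D^{(1)}]$ invariant under $\varrho_{D^{(1)}}(\mathrm{SL}_2(\mathbb{Z}))$.
   Context: $D^{(1)}$ is the discriminant group of the lattice $H(N)\oplus H(1)$ (a discriminant form of signature 0). The Weil representation $\varrho_D$ on $\mathbb{C}[D]$ with standard basis $\mathfrak{e}_\gamma$ is given by $\varrho_D(T)\mathfrak{e}_\gamma=e^{2\pi i Q(\gamma)}\mathfrak{e}_\gamma$ and $\varrho_D(S)\mathfrak{e}_\gamma=\frac{1}{\sqrt{|D|}}\sum_{\beta}e^{ -2\pi i(\beta,\gamma)}\mathfrak{e}_\beta$ (signature 0), with $T=(\begin{smallmatrix}1&1\\0&1\end{smallmatrix})$, $S=(\begin{smallmatrix}0&-1\\1&0\end{smallmatrix})$ and bilinear form $((x,y),(x',y'))=(xy'+x'y)/N$. Holomorphic weight-0 modular forms for $\varrho_D$ are exactly the constant invariant vectors. -}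

module Defs where

open import Level using (_⊔_)
open import Algebra.Bundles using (CommutativeRing; Semiring)
open import Data.Nat using (ℕ; zero; suc; _≤_; _<_; _∸_; _%_; _/_; NonZero) renaming (_+_ to _+ℕ_; _*_ to _*ℕ_)
open import Data.Nat.Divisibility using (_∣?_)
open import Data.Fin using (Fin; toℕ)
open import Data.Product using (_×_; _,_; ∃)
open import Data.Bool using (if_then_else_; _∧_)
open import Relation.Nullary using (¬_; does)
open import Relation.Binary.PropositionalEquality using (_≡_)

-- All definitions are relative to a commutative ring R, which in the
-- statement is additionally required to be a field of characteristic 0
-- (playing the role of ℂ).
module Weil {c ℓ} (R : CommutativeRing c ℓ) where
  open CommutativeRing R
  open import Algebra.Definitions.RawSemiring (Semiring.rawSemiring semiring) using (_^_; sum) renaming (_×_ to _·_)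

  IsField : Set (c ⊔ ℓ)
  IsField = (¬ (0# ≈ 1#)) × (∀ x → ¬ (x ≈ 0#) → ∃ λ y → x * y ≈ 1#)

  CharZero : Set ℓ
  CharZero = ∀ (n : ℕ) → n · 1# ≈ 0# → n ≡ 0

  -- ζ is a primitive N-th root of unity (plays the role of e^{2πi/N})
  PrimitiveRoot : ℕ → Carrier → Set ℓ
  PrimitiveRoot N ζ = (ζ ^ N ≈ 1#) × (∀ k → 0 < k → k < N → ¬ (ζ ^ k ≈ 1#))

  D : ℕ → Set
  D N = Fin N × Fin N

  -- vectors of R[D] = coefficient functions  D → R  (v = Σ_γ v γ 𝔢_γ)
  Vect : ℕ → Set c
  Vect N = D N → Carrier

  sumD : ∀ {N} → (D N → Carrier) → Carrier
  sumD f = sum (λ x → sum (λ y → f (x , y)))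

  module _ (N : ℕ) .{{_ : NonZero N}} (ζ : Carrier) where

    -- e(k/N) = ζ^k  and  e(-k/N) = ζ^{N - (k mod N)}
    e+ : ℕ → Carrier
    e+ k = ζ ^ (k % N)

    e- : ℕ → Carrier
    e- k = ζ ^ (N ∸ (k % N))

    -- N·Q(x,y) = x y  and  N·(β,γ) = x y' + x' y
    NQ : D N → ℕ
    NQ (x , y) = toℕ x *ℕ toℕ y

    NB : D N → D N → ℕ
    NB (x , y) (x' , y') = toℕ x *ℕ toℕ y' +ℕ toℕ x' *ℕ toℕ y

    -- Weil representation on coefficient vectors:
    -- ρ(T) 𝔢_γ = e(Q γ) 𝔢_γ,  ρ(S) 𝔢_γ = (1/N) Σ_β e(-(β,γ)) 𝔢_β   (|D| = N², √|D| = N)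
    ρT : Vect N → Vect N
    ρT v γ = e+ (NQ γ) * v γ

    -- ρS given an element u with N·u = 1 (u = 1/N)
    ρS : Carrier → Vect N → Vect N
    ρS u v β = u * sumD (λ γ → e- (NB β γ) * v γ)

    -- v is invariant under ρ(SL₂(ℤ)) = ⟨ρ(S), ρ(T)⟩
    Invariant : Vect N → Set (c ⊔ ℓ)
    Invariant v = (∀ γ → ρT v γ ≈ v γ)
                × (∀ u → (N · 1#) * u ≈ 1# → ∀ β → ρS u v β ≈ v β)

  vH : (N : ℕ) (d : ℕ) .{{_ : NonZero d}} → Vect N
  vH N d (x , y) =
    if does (d ∣? toℕ x) ∧ does ((N / d) ∣? toℕ y) then 1# else 0#

  -- divisors of N are indexed by k : Fin N via d = k + 1;
  -- linear combination Σ_{d ∣ N} c_d v^{H_d}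
  lincomb : (N : ℕ) → (Fin N → Carrier) → Vect N
  lincomb N cf γ =
    sum (λ k → if does (suc (toℕ k) ∣? N) then cf k * vH N (suc (toℕ k)) γ else 0#)

-- An invariant v is fixed by ρ(T) and ρ(S). Take its Fourier transform in the second
-- coordinate, ŵ(x, a) = Σ_y e(-a y / N) v(x, y). Invariance under T makes ŵ(x, ·) periodic
-- under a ↦ a + x, and invariance under S gives ŵ(x, a) = ŵ(-a, x). These moves generate an
-- action of SL₂(ℤ) on (x, a), so by Euclid's algorithm ŵ(x, a) only depends on
-- g = gcd(x, a, N). Writing this function of g as Σ_{d ∣ g, d ∣ N} c_d (a triangular system
-- over the divisors of N) and noting that the transform of Σ_d (c_d / d) v^{H_d} is
-- Σ_{d ∣ x, d ∣ a, d ∣ N} c_d, Fourier inversion puts v in the span. The v^{H_d} are invariant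
-- because H_d is isotropic and equal to its own orthogonal complement, and independent because
-- the point (d, N/d) lies in H_{d'} only for d' = d.

module Submission where

open import Defs
open import Algebra.Bundles using (CommutativeRing; Semiring)
open import Data.Nat using (ℕ; suc; NonZero)
open import Data.Nat.Divisibility using (_∣_)
open import Data.Fin using (Fin; toℕ)
open import Data.Product using (_×_; ∃)

open import Data.Nat as ℕ using (zero; _<_; _≤_; _∸_; _%_; _/_; z≤n; s≤s) renaming (_+_ to _+ℕ_; _*_ to _*ℕ_)
import Data.Nat.Properties as ℕ
open import Data.Nat.DivMod
  using (_mod_; m%n<n; m%n%n≡m%n; %-distribˡ-+; %-distribˡ-*; [m+kn]%n≡m%n; m<n⇒m%n≡m; m≡m%n+[m/n]*n; m/n*n≡m; m*[n/m]≡n)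
open import Data.Nat.Divisibility
  using (_∣?_; divides; ∣-refl; ∣-trans; ∣-antisym; m%n≡0⇒n∣m; n∣m⇒m%n≡0; ∣n∣m%n⇒∣m; %-presˡ-∣; ∣⇒≤;
         ∣m+n∣m⇒∣n; ∣m∣n⇒∣m+n; *-monoˡ-∣; *-cancelˡ-∣; 0∣⇒≡0; m∣m*n; ∣n⇒∣m*n; *-pres-∣; m/n∣m)
open import Data.Nat.GCD using (gcd; gcd[m,n]∣m; gcd[m,n]∣n; gcd-greatest; gcd-universality; gcd-comm; gcd-identityˡ; gcd-identityʳ)
open import Data.Nat.Induction using (<-wellFounded)
open import Induction.WellFounded using (Acc; acc)
open import Data.Sum using ([_,_]′)
open import Data.Fin as Fin using (fromℕ<; _≟_)
import Data.Fin.Properties as Finₚ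
open import Data.Product using (_,_; proj₁; proj₂)
open import Data.Bool using (if_then_else_; _∧_)
open import Function.Bundles using (_⇔_; mk⇔; Equivalence)
open import Relation.Nullary using (¬_; Dec; does; yes; no; contradiction)
open import Relation.Binary.PropositionalEquality using (_≡_; _≢_; cong; cong₂; subst)
import Relation.Binary.PropositionalEquality as ≡

gcd[m%n,n]≡gcd[m,n] : ∀ m n .{{_ : NonZero n}} → gcd (m % n) n ≡ gcd m n
gcd[m%n,n]≡gcd[m,n] m n = ≡.sym (gcd-universality
  (λ (d∣m%n , d∣n) → gcd-greatest (∣n∣m%n⇒∣m d∣n d∣m%n) d∣n)
  (λ d∣g → let d∣n = ∣-trans d∣g (gcd[m,n]∣n m n) in %-presˡ-∣ (∣-trans d∣g (gcd[m,n]∣m m n)) d∣n , d∣n))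

cofactor-∣⇒≡ : ∀ {N d d'} .{{_ : NonZero N}} .{{_ : NonZero d}} .{{_ : NonZero d'}} →
               d ∣ N → d' ∣ N → d' ∣ d → N / d' ∣ N / d → d' ≡ d
cofactor-∣⇒≡ {N} {d} {d'} d∣N d'∣N d'∣d q'∣q = ∣-antisym d'∣d (*-cancelˡ-∣ (N / d') {{q'≢0}} q'd∣q'd')
  where
  q'≢0 : NonZero (N / d')
  q'≢0 = ℕ.≢-nonZero (λ q'≡0 → ℕ.≢-nonZero⁻¹ N (≡.trans (≡.sym (m/n*n≡m d'∣N)) (cong (_*ℕ d') q'≡0)))
  q'd∣q'd' : (N / d') *ℕ d ∣ (N / d') *ℕ d'
  q'd∣q'd' = subst ((N / d') *ℕ d ∣_) (≡.trans (m/n*n≡m d∣N) (≡.sym (m/n*n≡m d'∣N))) (*-monoˡ-∣ d q'∣q)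

module ModularArithmetic (n : ℕ) where

  private
    N : ℕ
    N = suc n

  -- A record rather than a synonym, so that a and b can be inferred from a proof.
  infix 4 _≡ₘ_
  record _≡ₘ_ (a b : ℕ) : Set where
    constructor mk≡ₘ
    field %-≡ : a % N ≡ b % N
  open _≡ₘ_ public

  ≡ₘ-refl : ∀ {a} → a ≡ₘ a
  ≡ₘ-refl = mk≡ₘ ≡.refl

  ≡⇒≡ₘ : ∀ {a b} → a ≡ b → a ≡ₘ b
  ≡⇒≡ₘ e = mk≡ₘ (cong (_% N) e)

  ≡ₘ-sym : ∀ {a b} → a ≡ₘ b → b ≡ₘ a
  ≡ₘ-sym (mk≡ₘ e) = mk≡ₘ (≡.sym e)

  ≡ₘ-trans : ∀ {a b c} → a ≡ₘ b → b ≡ₘ c → a ≡ₘ c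
  ≡ₘ-trans (mk≡ₘ e) (mk≡ₘ f) = mk≡ₘ (≡.trans e f)

  +-congₘ : ∀ {a b c d} → a ≡ₘ b → c ≡ₘ d → a +ℕ c ≡ₘ b +ℕ d
  +-congₘ {a} {b} {c} {d} (mk≡ₘ p) (mk≡ₘ q) = mk≡ₘ (begin
    (a +ℕ c) % N             ≡⟨ %-distribˡ-+ a c N ⟩
    (a % N +ℕ c % N) % N     ≡⟨ cong₂ (λ s t → (s +ℕ t) % N) p q ⟩
    (b % N +ℕ d % N) % N     ≡⟨ %-distribˡ-+ b d N ⟨
    (b +ℕ d) % N             ∎)
    where open ≡.≡-Reasoning

  *-congʳ-≡ₘ : ∀ {a b} c → a ≡ₘ b → a *ℕ c ≡ₘ b *ℕ c
  *-congʳ-≡ₘ {a} {b} c (mk≡ₘ p) = mk≡ₘ (begin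
    (a *ℕ c) % N             ≡⟨ %-distribˡ-* a c N ⟩
    ((a % N) *ℕ (c % N)) % N     ≡⟨ cong (λ s → (s *ℕ (c % N)) % N) p ⟩
    ((b % N) *ℕ (c % N)) % N     ≡⟨ %-distribˡ-* b c N ⟨
    (b *ℕ c) % N             ∎)
    where open ≡.≡-Reasoning

  %-≡ₘ : ∀ a → a % N ≡ₘ a
  %-≡ₘ a = mk≡ₘ (m%n%n≡m%n a N)

  +-*N-≡ₘ : ∀ a k → a +ℕ k *ℕ N ≡ₘ a
  +-*N-≡ₘ a k = mk≡ₘ ([m+kn]%n≡m%n a k N)

  ∣⇒≡ₘ0 : ∀ {a} → N ∣ a → a ≡ₘ 0
  ∣⇒≡ₘ0 {a} p = mk≡ₘ (n∣m⇒m%n≡0 a N p)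

  ≡ₘ0⇒∣ : ∀ {a} → a ≡ₘ 0 → N ∣ a
  ≡ₘ0⇒∣ {a} (mk≡ₘ p) = m%n≡0⇒n∣m a N p

  -- adding c * n to both sides turns the c into c * N
  +-cancelʳ-≡ₘ : ∀ a b c → a +ℕ c ≡ₘ b +ℕ c → a ≡ₘ b
  +-cancelʳ-≡ₘ a b c e =
    ≡ₘ-trans (≡ₘ-sym (+-*N-≡ₘ a c)) (≡ₘ-trans (≡⇒≡ₘ (regroup a))
      (≡ₘ-trans (+-congₘ e (≡ₘ-refl {c *ℕ n}))
        (≡ₘ-trans (≡⇒≡ₘ (≡.sym (regroup b))) (+-*N-≡ₘ b c))))
    where
    regroup : ∀ z → z +ℕ c *ℕ N ≡ (z +ℕ c) +ℕ c *ℕ n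
    regroup z = ≡.trans (cong (z +ℕ_) (ℕ.*-suc c n)) (≡.sym (ℕ.+-assoc z c (c *ℕ n)))

  toℕ-mod : ∀ a → toℕ (a mod N) ≡ a % N
  toℕ-mod a = Finₚ.toℕ-fromℕ< (m%n<n a N)

  toℕ-injectiveₘ : ∀ {x y : Fin N} → toℕ x ≡ₘ toℕ y → x ≡ y
  toℕ-injectiveₘ {x} {y} (mk≡ₘ e) = Finₚ.toℕ-injective
    (≡.trans (≡.sym (m<n⇒m%n≡m (Finₚ.toℕ<n x))) (≡.trans e (m<n⇒m%n≡m (Finₚ.toℕ<n y))))

  toℕ-mod-≡ₘ : ∀ a → toℕ (a mod N) ≡ₘ a
  toℕ-mod-≡ₘ a = ≡ₘ-trans (≡⇒≡ₘ (toℕ-mod a)) (%-≡ₘ a)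

  mod-cong : ∀ {a b} → a ≡ₘ b → a mod N ≡ b mod N
  mod-cong {a} {b} e = toℕ-injectiveₘ (≡ₘ-trans (toℕ-mod-≡ₘ a) (≡ₘ-trans e (≡ₘ-sym (toℕ-mod-≡ₘ b))))

  mod-toℕ : ∀ (x : Fin N) → toℕ x mod N ≡ x
  mod-toℕ x = toℕ-injectiveₘ (toℕ-mod-≡ₘ (toℕ x))

  ∣+-unique : ∀ a {x y : Fin N} → N ∣ a +ℕ toℕ x → N ∣ a +ℕ toℕ y → x ≡ y
  ∣+-unique a {x} {y} p q = toℕ-injectiveₘ (+-cancelʳ-≡ₘ (toℕ x) (toℕ y) a
    (≡ₘ-trans (≡⇒≡ₘ (ℕ.+-comm (toℕ x) a))
      (≡ₘ-trans (∣⇒≡ₘ0 p) (≡ₘ-trans (≡ₘ-sym (∣⇒≡ₘ0 q)) (≡⇒≡ₘ (ℕ.+-comm a (toℕ y)))))))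

  ∣-mod⇔ : ∀ {e} a → e ∣ N → e ∣ toℕ (a mod N) ⇔ e ∣ a
  ∣-mod⇔ a e∣N = mk⇔ (λ p → ∣n∣m%n⇒∣m e∣N (subst (_ ∣_) (toℕ-mod a) p))
                     (λ p → subst (_ ∣_) (≡.sym (toℕ-mod a)) (%-presˡ-∣ p e∣N))

module Summation {c ℓ} (S : Semiring c ℓ) where
  open Semiring S
  open import Algebra.Definitions.RawSemiring rawSemiring using (sum) renaming (_×_ to _·_)
  open import Algebra.Properties.Semiring.Sum S using (sum-cong-≋; sum-replicate-zero)
  open import Relation.Binary.Reasoning.Setoid setoid

  sum-zero : ∀ {m} {f : Fin m → Carrier} → (∀ i → f i ≈ 0#) → sum f ≈ 0#
  sum-zero {m} p = trans (sum-cong-≋ p) (sum-replicate-zero m)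

  sum-single : ∀ {m} (f : Fin m → Carrier) i → (∀ j → j ≢ i → f j ≈ 0#) → sum f ≈ f i
  sum-single f Fin.zero p =
    trans (+-congˡ (sum-zero (λ j → p (Fin.suc j) λ ()))) (+-identityʳ _)
  sum-single f (Fin.suc i) p =
    trans (+-congʳ (p Fin.zero λ ()))
      (trans (+-identityˡ _) (sum-single (λ j → f (Fin.suc j)) i (λ j j≢i → p (Fin.suc j) (λ e → j≢i (Finₚ.suc-injective e)))))

  𝟙[_] : ∀ {p} {P : Set p} → Dec P → Carrier
  𝟙[ d ] = if does d then 1# else 0#

  𝟙-yes : ∀ {p} {P : Set p} (d : Dec P) → P → 𝟙[ d ] ≈ 1#
  𝟙-yes (yes _) _ = refl
  𝟙-yes (no ¬p) p = contradiction p ¬p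

  𝟙-no : ∀ {p} {P : Set p} (d : Dec P) → ¬ P → 𝟙[ d ] ≈ 0#
  𝟙-no (yes p) ¬p = contradiction p ¬p
  𝟙-no (no _) _ = refl

  𝟙-cong : ∀ {p q} {P : Set p} {Q : Set q} (d : Dec P) (e : Dec Q) → P ⇔ Q → 𝟙[ d ] ≈ 𝟙[ e ]
  𝟙-cong (yes p) e P⇔Q = sym (𝟙-yes e (Equivalence.to P⇔Q p))
  𝟙-cong (no ¬p) e P⇔Q = sym (𝟙-no e (λ q → ¬p (Equivalence.from P⇔Q q)))

  𝟙-∧ : ∀ {p q} {P : Set p} {Q : Set q} (d : Dec P) (e : Dec Q) →
        (if does d ∧ does e then 1# else 0#) ≈ 𝟙[ d ] * 𝟙[ e ]
  𝟙-∧ (yes _) e = sym (*-identityˡ _)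
  𝟙-∧ (no _) e = sym (zeroˡ _)

  if-else-0 : ∀ {p} {P : Set p} (d : Dec P) x → (if does d then x else 0#) ≈ 𝟙[ d ] * x
  if-else-0 (yes _) x = sym (*-identityˡ x)
  if-else-0 (no _) x = sym (zeroˡ x)

  𝟙-*-cong : ∀ {p} {P : Set p} (d : Dec P) {x y} → (P → x ≈ y) → 𝟙[ d ] * x ≈ 𝟙[ d ] * y
  𝟙-*-cong (yes p) x≈y = *-congˡ (x≈y p)
  𝟙-*-cong (no _) _ = trans (zeroˡ _) (sym (zeroˡ _))

  𝟙-∣-gcd : ∀ d a b → 𝟙[ d ∣? a ] * 𝟙[ d ∣? b ] ≈ 𝟙[ d ∣? gcd a b ]
  𝟙-∣-gcd d a b with d ∣? a | d ∣? b
  ... | yes d∣a | yes d∣b = trans (*-identityˡ 1#) (sym (𝟙-yes (d ∣? gcd a b) (gcd-greatest d∣a d∣b)))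
  ... | yes _   | no d∤b  = trans (zeroʳ 1#) (sym (𝟙-no (d ∣? gcd a b) (λ d∣g → d∤b (∣-trans d∣g (gcd[m,n]∣n a b)))))
  ... | no d∤a  | _       = trans (zeroˡ _) (sym (𝟙-no (d ∣? gcd a b) (λ d∣g → d∤a (∣-trans d∣g (gcd[m,n]∣m a b)))))

  ∑ℕ : ℕ → (ℕ → Carrier) → Carrier
  ∑ℕ zero f = 0#
  ∑ℕ (suc m) f = f 0 + ∑ℕ m (λ y → f (suc y))

  sum≡∑ℕ : ∀ m (f : ℕ → Carrier) → sum {m} (λ i → f (toℕ i)) ≡ ∑ℕ m f
  sum≡∑ℕ zero f = ≡.refl
  sum≡∑ℕ (suc m) f = cong (f 0 +_) (sum≡∑ℕ m (λ y → f (suc y)))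

  ∑ℕ-cong : ∀ m {f g : ℕ → Carrier} → (∀ y → y < m → f y ≈ g y) → ∑ℕ m f ≈ ∑ℕ m g
  ∑ℕ-cong zero p = refl
  ∑ℕ-cong (suc m) p = +-cong (p 0 (s≤s z≤n)) (∑ℕ-cong m (λ y y<m → p (suc y) (s≤s y<m)))

  ∑ℕ-length-cong : ∀ {m m'} (f : ℕ → Carrier) → m ≡ m' → ∑ℕ m f ≈ ∑ℕ m' f
  ∑ℕ-length-cong f ≡.refl = refl

  ∑ℕ-zero : ∀ m {f : ℕ → Carrier} → (∀ y → y < m → f y ≈ 0#) → ∑ℕ m f ≈ 0#
  ∑ℕ-zero zero p = refl
  ∑ℕ-zero (suc m) p = trans (+-cong (p 0 (s≤s z≤n)) (∑ℕ-zero m (λ y y<m → p (suc y) (s≤s y<m)))) (+-identityˡ _)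

  ∑ℕ-+ : ∀ a b (f : ℕ → Carrier) → ∑ℕ (a +ℕ b) f ≈ ∑ℕ a f + ∑ℕ b (λ y → f (a +ℕ y))
  ∑ℕ-+ zero b f = sym (+-identityˡ _)
  ∑ℕ-+ (suc a) b f = trans (+-congˡ (∑ℕ-+ a b (λ y → f (suc y)))) (sym (+-assoc _ _ _))

  *-distribˡ-∑ℕ : ∀ m x (f : ℕ → Carrier) → x * ∑ℕ m f ≈ ∑ℕ m (λ y → x * f y)
  *-distribˡ-∑ℕ zero x f = zeroʳ x
  *-distribˡ-∑ℕ (suc m) x f = trans (distribˡ _ _ _) (+-congˡ (*-distribˡ-∑ℕ m x _))

  ∑ℕ-1 : ∀ m → ∑ℕ m (λ _ → 1#) ≈ m · 1#
  ∑ℕ-1 zero = refl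
  ∑ℕ-1 (suc m) = +-congˡ (∑ℕ-1 m)

  ∑ℕ-multiples : ∀ k d (f : ℕ → Carrier) →
    ∑ℕ (suc k *ℕ d) (λ y → 𝟙[ suc k ∣? y ] * f y) ≈ ∑ℕ d (λ b → f (suc k *ℕ b))
  ∑ℕ-multiples k zero f = ∑ℕ-length-cong _ (ℕ.*-zeroʳ k)
  ∑ℕ-multiples k (suc d) f = begin
    ∑ℕ (m *ℕ suc d) g                          ≈⟨ ∑ℕ-length-cong g (ℕ.*-suc m d) ⟩
    ∑ℕ (m +ℕ m *ℕ d) g                         ≈⟨ ∑ℕ-+ m (m *ℕ d) g ⟩
    ∑ℕ m g + ∑ℕ (m *ℕ d) (λ y → g (m +ℕ y))    ≈⟨ +-cong first-block other-blocks ⟩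
    f 0 + ∑ℕ d (λ b → f (m +ℕ m *ℕ b))         ≈⟨ +-congʳ (reflexive (cong f (ℕ.*-zeroʳ m))) ⟨
    f (m *ℕ 0) + ∑ℕ d (λ b → f (m +ℕ m *ℕ b))  ≈⟨ +-congˡ (∑ℕ-cong d (λ b _ → reflexive (cong f (≡.sym (ℕ.*-suc m b))))) ⟩
    f (m *ℕ 0) + ∑ℕ d (λ b → f (m *ℕ suc b))   ∎
    where
    m = suc k
    g : ℕ → Carrier
    g y = 𝟙[ m ∣? y ] * f y
    first-block : ∑ℕ m g ≈ f 0
    first-block = trans (+-cong (trans (*-congʳ (𝟙-yes (m ∣? 0) (divides 0 ≡.refl))) (*-identityˡ _))
                                (∑ℕ-zero k (λ y y<k → trans (*-congʳ (𝟙-no (m ∣? suc y) λ m∣y+1 →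
                                  ℕ.<⇒≱ (s≤s y<k) (∣⇒≤ m∣y+1))) (zeroˡ _))))
                        (+-identityʳ _)
    other-blocks : ∑ℕ (m *ℕ d) (λ y → g (m +ℕ y)) ≈ ∑ℕ d (λ b → f (m +ℕ m *ℕ b))
    other-blocks = trans (∑ℕ-cong (m *ℕ d) (λ y _ → *-congʳ (𝟙-cong (m ∣? (m +ℕ y)) (m ∣? y)
                           (mk⇔ (λ p → ∣m+n∣m⇒∣n p ∣-refl) (∣m∣n⇒∣m+n ∣-refl)))))
                         (∑ℕ-multiples k d (λ y → f (m +ℕ y)))

module RootsOfUnity {c ℓ} (R : CommutativeRing c ℓ) where
  open CommutativeRing R hiding (zero)
  open Weil R using (IsField; PrimitiveRoot)
  open Summation semiring
  open import Algebra.Definitions.RawSemiring (Semiring.rawSemiring semiring) using (_^_) renaming (_×_ to _·_)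
  open import Algebra.Properties.Semiring.Exp semiring using (^-congˡ; ^-congʳ; ^-homo-*; ^-assocʳ)
  open import Algebra.Properties.Ring ring using ([y-z]x≈yx-zx)
  open import Algebra.Properties.Group +-group using (∙-cancelʳ; x∙y⁻¹≈ε⇒x≈y)
  open import Relation.Binary.Reasoning.Setoid setoid

  1^≈1 : ∀ k → 1# ^ k ≈ 1#
  1^≈1 zero = refl
  1^≈1 (suc k) = trans (*-identityˡ _) (1^≈1 k)

  module _ {ξ M} (ξ^M≈1 : ξ ^ M ≈ 1#) where

    ^-*≈1 : ∀ q → ξ ^ (q *ℕ M) ≈ 1#
    ^-*≈1 q = begin
      ξ ^ (q *ℕ M)  ≡⟨ cong (ξ ^_) (ℕ.*-comm q M) ⟩
      ξ ^ (M *ℕ q)  ≈⟨ ^-assocʳ ξ M q ⟨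
      (ξ ^ M) ^ q   ≈⟨ ^-congˡ q ξ^M≈1 ⟩
      1# ^ q        ≈⟨ 1^≈1 q ⟩
      1#            ∎

    ∣⇒^≈1 : ∀ {k} → M ∣ k → ξ ^ k ≈ 1#
    ∣⇒^≈1 (divides q ≡.refl) = ^-*≈1 q

    ^-% : .{{_ : NonZero M}} → ∀ k → ξ ^ k ≈ ξ ^ (k % M)
    ^-% k = begin
      ξ ^ k                              ≡⟨ cong (ξ ^_) (m≡m%n+[m/n]*n k M) ⟩
      ξ ^ (k % M +ℕ (k / M) *ℕ M)        ≈⟨ ^-homo-* ξ (k % M) _ ⟩
      ξ ^ (k % M) * ξ ^ ((k / M) *ℕ M)   ≈⟨ *-congˡ (^-*≈1 (k / M)) ⟩
      ξ ^ (k % M) * 1#                   ≈⟨ *-identityʳ _ ⟩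
      ξ ^ (k % M)                        ∎

  geometric-sum : ∀ ξ m → ξ * ∑ℕ m (ξ ^_) + 1# ≈ ∑ℕ m (ξ ^_) + ξ ^ m
  geometric-sum ξ m = begin
    ξ * ∑ℕ m (ξ ^_) + 1#                 ≈⟨ +-comm _ _ ⟩
    1# + ξ * ∑ℕ m (ξ ^_)                 ≈⟨ +-congˡ (*-distribˡ-∑ℕ m ξ (ξ ^_)) ⟩
    ∑ℕ (suc m) (ξ ^_)                    ≡⟨ cong (λ l → ∑ℕ l (ξ ^_)) (ℕ.+-comm 1 m) ⟩
    ∑ℕ (m +ℕ 1) (ξ ^_)                   ≈⟨ ∑ℕ-+ m 1 (ξ ^_) ⟩
    ∑ℕ m (ξ ^_) + (ξ ^ (m +ℕ 0) + 0#)    ≈⟨ +-congˡ (trans (+-identityʳ _) (^-congʳ ξ (ℕ.+-identityʳ m))) ⟩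
    ∑ℕ m (ξ ^_) + ξ ^ m                  ∎

  geometric-sum-1 : ∀ {ξ} m → ξ ≈ 1# → ∑ℕ m (ξ ^_) ≈ m · 1#
  geometric-sum-1 m ξ≈1 = trans (∑ℕ-cong m (λ y _ → trans (^-congˡ y ξ≈1) (1^≈1 y))) (∑ℕ-1 m)

  ^-primitive : ∀ {N ξ} → PrimitiveRoot N ξ → ∀ k d → suc k *ℕ d ≡ N → PrimitiveRoot d (ξ ^ suc k)
  ^-primitive {N} {ξ} prim k d md≡N =
      trans (^-assocʳ ξ m d) (trans (^-congʳ ξ md≡N) (proj₁ prim))
    , λ j 0<j j<d ξ^mj≈1 → proj₂ prim (m *ℕ j)
        (subst (_< m *ℕ j) (ℕ.*-zeroʳ m) (ℕ.*-monoʳ-< m 0<j))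
        (subst (m *ℕ j <_) md≡N (ℕ.*-monoʳ-< m j<d))
        (trans (sym (^-assocʳ ξ m j)) ξ^mj≈1)
    where m = suc k

  module _ (isField : IsField) where

    *-cancelˡ-≉0 : ∀ {z x y} → ¬ z ≈ 0# → z * x ≈ z * y → x ≈ y
    *-cancelˡ-≉0 {z} {x} {y} z≉0 zx≈zy = begin
      x              ≈⟨ *-identityˡ x ⟨
      1# * x         ≈⟨ *-congʳ z⁻¹z≈1 ⟨
      (z⁻¹ * z) * x  ≈⟨ *-assoc _ _ _ ⟩
      z⁻¹ * (z * x)  ≈⟨ *-congˡ zx≈zy ⟩
      z⁻¹ * (z * y)  ≈⟨ *-assoc _ _ _ ⟨
      (z⁻¹ * z) * y  ≈⟨ *-congʳ z⁻¹z≈1 ⟩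
      1# * y         ≈⟨ *-identityˡ y ⟩
      y              ∎
      where
      z⁻¹ = proj₁ (proj₂ isField z z≉0)
      z⁻¹z≈1 = trans (*-comm _ _) (proj₂ (proj₂ isField z z≉0))

    -- (ξ - 1) Σ ξ^y = ξ^m - 1 = 0, and ξ - 1 is invertible
    geometric-sum-root : ∀ {ξ} m → ξ ^ m ≈ 1# → ¬ ξ ≈ 1# → ∑ℕ m (ξ ^_) ≈ 0#
    geometric-sum-root {ξ} m ξ^m≈1 ξ≉1 = *-cancelˡ-≉0 (λ ξ-1≈0 → ξ≉1 (x∙y⁻¹≈ε⇒x≈y ξ 1# ξ-1≈0)) (begin
      (ξ - 1#) * G         ≈⟨ [y-z]x≈yx-zx G ξ 1# ⟩
      ξ * G - 1# * G       ≈⟨ +-cong ξG≈G (-‿cong (*-identityˡ G)) ⟩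
      G - G                ≈⟨ -‿inverseʳ G ⟩
      0#                   ≈⟨ zeroʳ _ ⟨
      (ξ - 1#) * 0#        ∎)
      where
      G = ∑ℕ m (ξ ^_)
      ξG≈G : ξ * G ≈ G
      ξG≈G = ∙-cancelʳ 1# _ _ (trans (geometric-sum ξ m) (+-congˡ ξ^m≈1))

    module Primitive (N : ℕ) .{{_ : NonZero N}} {ξ} (prim : PrimitiveRoot N ξ) where

      ^≈1⇒∣ : ∀ k → ξ ^ k ≈ 1# → N ∣ k
      ^≈1⇒∣ k ξ^k≈1 with k % N in k%N≡r
      ... | zero = m%n≡0⇒n∣m k N k%N≡r
      ... | suc r = contradiction (trans (^-congʳ ξ (≡.sym k%N≡r)) (trans (sym (^-% (proj₁ prim) k)) ξ^k≈1))
                      (proj₂ prim (suc r) (s≤s z≤n) (subst (_< N) k%N≡r (m%n<n k N)))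

      character-sum-∣ : ∀ j → N ∣ j → ∑ℕ N (λ y → ξ ^ (j *ℕ y)) ≈ N · 1#
      character-sum-∣ j N∣j = trans (∑ℕ-cong N (λ y _ → sym (^-assocʳ ξ j y)))
                                    (geometric-sum-1 N (∣⇒^≈1 (proj₁ prim) N∣j))

      character-sum-∤ : ∀ j → ¬ N ∣ j → ∑ℕ N (λ y → ξ ^ (j *ℕ y)) ≈ 0#
      character-sum-∤ j N∤j = trans (∑ℕ-cong N (λ y _ → sym (^-assocʳ ξ j y)))
        (geometric-sum-root N (trans (^-assocʳ ξ j N) (^-*≈1 (proj₁ prim) j)) (λ ξ^j≈1 → N∤j (^≈1⇒∣ j ξ^j≈1)))

    subgroup-character-sum : ∀ N .{{_ : NonZero N}} {ξ} → PrimitiveRoot N ξ → ∀ k d → suc k *ℕ d ≡ N → ∀ a →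
      ∑ℕ N (λ y → 𝟙[ suc k ∣? y ] * ξ ^ (a *ℕ y)) ≈ 𝟙[ d ∣? a ] * (d · 1#)
    subgroup-character-sum N {ξ} prim k d md≡N a = begin
      ∑ℕ N (λ y → 𝟙[ m ∣? y ] * ξ ^ (a *ℕ y))        ≈⟨ ∑ℕ-length-cong _ (≡.sym md≡N) ⟩
      ∑ℕ (m *ℕ d) (λ y → 𝟙[ m ∣? y ] * ξ ^ (a *ℕ y)) ≈⟨ ∑ℕ-multiples k d (λ y → ξ ^ (a *ℕ y)) ⟩
      ∑ℕ d (λ b → ξ ^ (a *ℕ (m *ℕ b)))               ≈⟨ ∑ℕ-cong d (λ b _ → sym (reorder b)) ⟩
      ∑ℕ d (λ b → (ξ ^ m) ^ (a *ℕ b))                ≈⟨ on-divisibility (d ∣? a) ⟩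
      𝟙[ d ∣? a ] * (d · 1#)                          ∎
      where
      m = suc k
      reorder : ∀ b → (ξ ^ m) ^ (a *ℕ b) ≈ ξ ^ (a *ℕ (m *ℕ b))
      reorder b = trans (^-assocʳ ξ m (a *ℕ b)) (^-congʳ ξ exponent)
        where
        exponent : m *ℕ (a *ℕ b) ≡ a *ℕ (m *ℕ b)
        exponent = ≡.trans (ℕ.*-comm m (a *ℕ b)) (≡.trans (ℕ.*-assoc a b m) (cong (a *ℕ_) (ℕ.*-comm b m)))
      d≢0 : d ≢ 0
      d≢0 ≡.refl = ℕ.≢-nonZero⁻¹ N (≡.trans (≡.sym md≡N) (ℕ.*-zeroʳ m))
      open Primitive d {{ℕ.≢-nonZero d≢0}} (^-primitive prim k d md≡N)
      on-divisibility : (p : Dec (d ∣ a)) → ∑ℕ d (λ b → (ξ ^ m) ^ (a *ℕ b)) ≈ 𝟙[ p ] * (d · 1#)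
      on-divisibility (yes d∣a) = trans (character-sum-∣ a d∣a) (sym (*-identityˡ _))
      on-divisibility (no d∤a) = trans (character-sum-∤ a d∤a) (sym (zeroˡ _))

module DivisorSums {c ℓ} (R : CommutativeRing c ℓ) (n : ℕ) where
  open CommutativeRing R hiding (zero)
  open Summation semiring
  open import Algebra.Definitions.RawSemiring (Semiring.rawSemiring semiring) using (sum)
  open import Algebra.Properties.Semiring.Sum semiring using (sum-cong-≋; ∑-distrib-+)
  open import Algebra.Properties.AbelianGroup +-abelianGroup using (xyx⁻¹≈y)
  open import Relation.Binary.Reasoning.Setoid setoid

  private
    N : ℕ
    N = suc n

  divisor-weight : Fin N → ℕ → Carrier
  divisor-weight k g = 𝟙[ suc (toℕ k) ∣? N ] * 𝟙[ suc (toℕ k) ∣? g ]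

  divisor-sum : (Fin N → Carrier) → ℕ → Carrier
  divisor-sum c g = sum (λ k → divisor-weight k g * c k)

  divisor-sum-bump : ∀ c i δ g →
    divisor-sum (λ k → c k + 𝟙[ k ≟ i ] * δ) g ≈ divisor-sum c g + divisor-weight i g * δ
  divisor-sum-bump c i δ g = begin
    sum (λ k → w k * (c k + e k))            ≈⟨ sum-cong-≋ (λ k → distribˡ (w k) (c k) (e k)) ⟩
    sum (λ k → w k * c k + w k * e k)        ≈⟨ ∑-distrib-+ (λ k → w k * c k) (λ k → w k * e k) ⟩
    divisor-sum c g + sum (λ k → w k * e k)  ≈⟨ +-congˡ (sum-single (λ k → w k * e k) i only-i) ⟩
    divisor-sum c g + w i * e i              ≈⟨ +-congˡ (*-congˡ (trans (*-congʳ (𝟙-yes (i ≟ i) ≡.refl)) (*-identityˡ δ))) ⟩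
    divisor-sum c g + w i * δ                ∎
    where
    w e : Fin N → Carrier
    w k = divisor-weight k g
    e k = 𝟙[ k ≟ i ] * δ
    only-i : ∀ k → k ≢ i → w k * e k ≈ 0#
    only-i k k≢i = trans (*-congˡ (trans (*-congʳ (𝟙-no (k ≟ i) k≢i)) (zeroˡ δ))) (zeroʳ _)

  divisor-weight-below : ∀ k g → g ≢ 0 → g < suc (toℕ k) → divisor-weight k g ≈ 0#
  divisor-weight-below k g g≢0 g<d = trans (*-congˡ (𝟙-no (suc (toℕ k) ∣? g)
    (λ d∣g → ℕ.<⇒≱ g<d (∣⇒≤ {{ℕ.≢-nonZero g≢0}} d∣g)))) (zeroʳ _)

  divisor-weight-self : ∀ k → suc (toℕ k) ∣ N → divisor-weight k (suc (toℕ k)) ≈ 1#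
  divisor-weight-self k d∣N =
    trans (*-cong (𝟙-yes (suc (toℕ k) ∣? N) d∣N) (𝟙-yes (suc (toℕ k) ∣? suc (toℕ k)) ∣-refl)) (*-identityˡ 1#)

  module _ (F : ℕ → Carrier) where

    SolvesUpTo : ℕ → (Fin N → Carrier) → Set ℓ
    SolvesUpTo B c = ∀ g → g ≤ B → g ∣ N → F g ≈ divisor-sum c g

    -- The system is triangular, so it is solved one divisor at a time.
    solve-up-to : ∀ B → ∃ (SolvesUpTo B)
    solve-up-to zero = (λ _ → 0#) , λ g g≤0 g∣N → contradiction (0∣⇒≡0 (subst (_∣ N) (ℕ.n≤0⇒n≡0 g≤0) g∣N)) λ ()
    solve-up-to (suc B) = extend (solve-up-to B) (suc B ∣? N)
      where
      extend : ∃ (SolvesUpTo B) → Dec (suc B ∣ N) → ∃ (SolvesUpTo (suc B))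
      extend (c , solves) (no B+1∤N) = c , λ g g≤B+1 g∣N →
        [ (λ g<B+1 → solves g (ℕ.≤-pred g<B+1) g∣N) , (λ { ≡.refl → contradiction g∣N B+1∤N }) ]′
        (ℕ.m≤n⇒m<n∨m≡n g≤B+1)
      extend (c , solves) (yes B+1∣N) = c' , λ g g≤B+1 g∣N →
        [ below g g∣N , (λ { ≡.refl → at-B+1 }) ]′ (ℕ.m≤n⇒m<n∨m≡n g≤B+1)
        where
        B<N : B < N
        B<N = ∣⇒≤ B+1∣N
        i : Fin N
        i = fromℕ< B<N
        d≡B+1 : suc (toℕ i) ≡ suc B
        d≡B+1 = cong suc (Finₚ.toℕ-fromℕ< B<N)
        δ : Carrier
        δ = F (suc B) - divisor-sum c (suc B)
        c' : Fin N → Carrier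
        c' k = c k + 𝟙[ k ≟ i ] * δ
        below : ∀ g → g ∣ N → g < suc B → F g ≈ divisor-sum c' g
        below g g∣N g<B+1 = begin
          F g                                        ≈⟨ solves g (ℕ.≤-pred g<B+1) g∣N ⟩
          divisor-sum c g                            ≈⟨ +-identityʳ _ ⟨
          divisor-sum c g + 0#                       ≈⟨ +-congˡ (trans (*-congʳ w≈0) (zeroˡ δ)) ⟨
          divisor-sum c g + divisor-weight i g * δ   ≈⟨ divisor-sum-bump c i δ g ⟨
          divisor-sum c' g                           ∎
          where
          g≢0 : g ≢ 0
          g≢0 g≡0 = contradiction (0∣⇒≡0 (subst (_∣ N) g≡0 g∣N)) λ ()
          w≈0 : divisor-weight i g ≈ 0#
          w≈0 = divisor-weight-below i g g≢0 (subst (g <_) (≡.sym d≡B+1) g<B+1)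
        at-B+1 : F (suc B) ≈ divisor-sum c' (suc B)
        at-B+1 = sym (begin
          divisor-sum c' (suc B)                            ≈⟨ divisor-sum-bump c i δ (suc B) ⟩
          divisor-sum c (suc B) + divisor-weight i (suc B) * δ ≡⟨ cong (λ g → divisor-sum c (suc B) + divisor-weight i g * δ) d≡B+1 ⟨
          divisor-sum c (suc B) + divisor-weight i (suc (toℕ i)) * δ
              ≈⟨ +-congˡ (trans (*-congʳ (divisor-weight-self i (subst (_∣ N) (≡.sym d≡B+1) B+1∣N))) (*-identityˡ δ)) ⟩
          divisor-sum c (suc B) + (F (suc B) - divisor-sum c (suc B)) ≈⟨ +-assoc _ _ _ ⟨
          divisor-sum c (suc B) + F (suc B) - divisor-sum c (suc B)   ≈⟨ xyx⁻¹≈y _ _ ⟩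
          F (suc B)                                                   ∎)

    divisor-sum-surjective : ∃ λ c → ∀ g → g ∣ N → F g ≈ divisor-sum c g
    divisor-sum-surjective = let (c , solves) = solve-up-to N in c , λ g g∣N → solves g (∣⇒≤ g∣N) g∣N

module WeilInvariants {ℓ₁ ℓ₂} (R : CommutativeRing ℓ₁ ℓ₂) (isField : Weil.IsField R) (charZero : Weil.CharZero R)
                      (n : ℕ) (ζ : CommutativeRing.Carrier R) (prim : Weil.PrimitiveRoot R (suc n) ζ) where
  open CommutativeRing R hiding (zero)
  open Weil R
  open Summation semiring
  open import Algebra.Properties.Semiring.Sum semiring using (sum-cong-≋; *-distribˡ-sum; ∑-comm)
  open RootsOfUnity R
  open ModularArithmetic n
  open DivisorSums R n
  open import Algebra.Definitions.RawSemiring (Semiring.rawSemiring semiring) using (_^_; sum) renaming (_×_ to _·_)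
  open import Algebra.Properties.Semiring.Exp semiring using (^-congˡ; ^-congʳ; ^-homo-*; ^-assocʳ)
  open import Algebra.Properties.CommutativeSemiring.Exp commutativeSemiring using (^-distrib-*)
  open import Algebra.Properties.CommutativeSemigroup *-commutativeSemigroup using (x∙yz≈y∙xz; x∙yz≈y∙zx; interchange)
  open import Algebra.Properties.Semiring.Mult semiring using (×1-homo-*)
  open import Relation.Binary.Reasoning.Setoid setoid

  N : ℕ
  N = suc n

  ζ⁻ : Carrier
  ζ⁻ = ζ ^ n

  ζ^*ζ⁻^≈1 : ∀ k → ζ ^ k * ζ⁻ ^ k ≈ 1#
  ζ^*ζ⁻^≈1 k = begin
    ζ ^ k * ζ⁻ ^ k   ≈⟨ ^-distrib-* ζ ζ⁻ k ⟨
    (ζ * ζ⁻) ^ k     ≈⟨ ^-congˡ k (proj₁ prim) ⟩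
    1# ^ k           ≈⟨ 1^≈1 k ⟩
    1#               ∎

  ζ⁻-primitive : PrimitiveRoot N ζ⁻
  ζ⁻-primitive = trans (^-assocʳ ζ n N) (^-*≈1 (proj₁ prim) n)
               , λ k 0<k k<N ζ⁻^k≈1 → proj₂ prim k 0<k k<N
                   (trans (sym (*-identityʳ _)) (trans (*-congˡ (sym ζ⁻^k≈1)) (ζ^*ζ⁻^≈1 k)))

  open Primitive isField N ζ⁻-primitive

  ^-≡ₘ : ∀ {ξ a b} → ξ ^ N ≈ 1# → a ≡ₘ b → ξ ^ a ≈ ξ ^ b
  ^-≡ₘ {ξ} {a} {b} ξ^N≈1 a≡b =
    trans (^-% ξ^N≈1 a) (trans (reflexive (cong (ξ ^_) (%-≡ a≡b))) (sym (^-% ξ^N≈1 b)))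

  e+≈ζ^ : ∀ k → e+ N ζ k ≈ ζ ^ k
  e+≈ζ^ k = sym (^-% (proj₁ prim) k)

  -- N ∸ (k % N) and n * k are both congruent to -k.
  e-≈ζ⁻^ : ∀ k → e- N ζ k ≈ ζ⁻ ^ k
  e-≈ζ⁻^ k = trans (^-≡ₘ (proj₁ prim) (+-cancelʳ-≡ₘ (N ∸ k % N) (n *ℕ k) k (≡ₘ-trans both≡0 (≡ₘ-sym nk+k≡0))))
                   (sym (^-assocʳ ζ n k))
    where
    both≡0 : N ∸ k % N +ℕ k ≡ₘ 0
    both≡0 = ≡ₘ-trans (+-congₘ (≡ₘ-refl {N ∸ k % N}) (≡ₘ-sym (%-≡ₘ k)))
               (≡ₘ-trans (≡⇒≡ₘ (ℕ.m∸n+n≡m (ℕ.<⇒≤ (m%n<n k N)))) (∣⇒≡ₘ0 ∣-refl))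
    nk+k≡0 : n *ℕ k +ℕ k ≡ₘ 0
    nk+k≡0 = ∣⇒≡ₘ0 (subst (N ∣_) (ℕ.+-comm k (n *ℕ k)) (m∣m*n k))

  suc·1≉0 : ∀ m → ¬ suc m · 1# ≈ 0#
  suc·1≉0 m m+1≈0 = contradiction (charZero (suc m) m+1≈0) λ ()

  1/suc : ℕ → Carrier
  1/suc m = proj₁ (proj₂ isField (suc m · 1#) (suc·1≉0 m))

  *-1/suc : ∀ m → (suc m · 1#) * 1/suc m ≈ 1#
  *-1/suc m = proj₂ (proj₂ isField (suc m · 1#) (suc·1≉0 m))

  -- ζ⁻ = ζ⁻¹ plays e(-1/N), so this is Σ_y e(-a y / N) f(y); the frequency a only matters mod N.
  fourier : (Fin N → Carrier) → ℕ → Carrier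
  fourier f a = sum (λ y → ζ⁻ ^ (a *ℕ toℕ y) * f y)

  fourier-cong : ∀ {f g} a → (∀ y → f y ≈ g y) → fourier f a ≈ fourier g a
  fourier-cong a f≈g = sum-cong-≋ {N} (λ y → *-congˡ {ζ⁻ ^ (a *ℕ toℕ y)} (f≈g y))

  fourier-≡ₘ : ∀ f {a b} → a ≡ₘ b → fourier f a ≈ fourier f b
  fourier-≡ₘ f {a} {b} a≡b = sum-cong-≋ {N} (λ y → *-congʳ {f y}
    (^-≡ₘ {ζ⁻} {a *ℕ toℕ y} {b *ℕ toℕ y} (proj₁ ζ⁻-primitive) (*-congʳ-≡ₘ (toℕ y) a≡b)))

  fourier-* : ∀ x f a → fourier (λ y → x * f y) a ≈ x * fourier f a
  fourier-* x f a = trans (sum-cong-≋ {N} (λ y → x∙yz≈y∙xz (ζ⁻ ^ (a *ℕ toℕ y)) x (f y)))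
                          (sym (*-distribˡ-sum x (λ y → ζ⁻ ^ (a *ℕ toℕ y) * f y)))

  fourier-sum : ∀ {m} (t : Fin m → Fin N → Carrier) a →
    fourier (λ y → sum (λ k → t k y)) a ≈ sum (λ k → fourier (t k) a)
  fourier-sum t a = trans (sum-cong-≋ {N} (λ y → *-distribˡ-sum (ζ⁻ ^ (a *ℕ toℕ y)) (λ k → t k y)))
                          (∑-comm (λ y k → ζ⁻ ^ (a *ℕ toℕ y) * t k y))

  fourier-shift : ∀ f a b → (∀ y → ζ⁻ ^ (b *ℕ toℕ y) * f y ≈ f y) → fourier f (a +ℕ b) ≈ fourier f a
  fourier-shift f a b invariant = sum-cong-≋ {N} λ y → begin
    ζ⁻ ^ ((a +ℕ b) *ℕ toℕ y) * f y                     ≡⟨ cong (λ e → ζ⁻ ^ e * f y) (ℕ.*-distribʳ-+ (toℕ y) a b) ⟩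
    ζ⁻ ^ (a *ℕ toℕ y +ℕ b *ℕ toℕ y) * f y              ≈⟨ *-congʳ (^-homo-* ζ⁻ (a *ℕ toℕ y) (b *ℕ toℕ y)) ⟩
    (ζ⁻ ^ (a *ℕ toℕ y) * ζ⁻ ^ (b *ℕ toℕ y)) * f y      ≈⟨ *-assoc _ _ _ ⟩
    ζ⁻ ^ (a *ℕ toℕ y) * (ζ⁻ ^ (b *ℕ toℕ y) * f y)      ≈⟨ *-congˡ {ζ⁻ ^ (a *ℕ toℕ y)} (invariant y) ⟩
    ζ⁻ ^ (a *ℕ toℕ y) * f y                            ∎

  sum-character-∣ : ∀ j → N ∣ j → sum (λ (y : Fin N) → ζ⁻ ^ (j *ℕ toℕ y)) ≈ N · 1#
  sum-character-∣ j N∣j = trans (reflexive (sum≡∑ℕ N (λ y → ζ⁻ ^ (j *ℕ y)))) (character-sum-∣ j N∣j)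

  sum-character-∤ : ∀ j → ¬ N ∣ j → sum (λ (y : Fin N) → ζ⁻ ^ (j *ℕ toℕ y)) ≈ 0#
  sum-character-∤ j N∤j = trans (reflexive (sum≡∑ℕ N (λ y → ζ⁻ ^ (j *ℕ y)))) (character-sum-∤ j N∤j)

  -- Orthogonality of characters: only the frequency x₀ ≡ -a survives.
  fourier² : ∀ h a x₀ → N ∣ a +ℕ toℕ x₀ → fourier (λ y → fourier h (toℕ y)) a ≈ (N · 1#) * h x₀
  fourier² h a x₀ N∣a+x₀ = begin
    sum {N} (λ y → ζ⁻ ^ (a *ℕ toℕ y) * sum {N} (λ x → ζ⁻ ^ (toℕ y *ℕ toℕ x) * h x))
      ≈⟨ sum-cong-≋ {N} (λ y → *-distribˡ-sum (ζ⁻ ^ (a *ℕ toℕ y)) (λ x → ζ⁻ ^ (toℕ y *ℕ toℕ x) * h x)) ⟩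
    sum {N} (λ y → sum {N} (λ x → ζ⁻ ^ (a *ℕ toℕ y) * (ζ⁻ ^ (toℕ y *ℕ toℕ x) * h x)))
      ≈⟨ ∑-comm {N} {N} (λ y x → ζ⁻ ^ (a *ℕ toℕ y) * (ζ⁻ ^ (toℕ y *ℕ toℕ x) * h x)) ⟩
    sum {N} (λ x → sum {N} (λ y → ζ⁻ ^ (a *ℕ toℕ y) * (ζ⁻ ^ (toℕ y *ℕ toℕ x) * h x)))
      ≈⟨ sum-cong-≋ {N} (λ x → trans (sum-cong-≋ {N} (collect x)) (sym (*-distribˡ-sum (h x) (χ x)))) ⟩
    sum {N} (λ x → h x * sum (χ x))
      ≈⟨ sum-single (λ x → h x * sum (χ x)) x₀ (λ x x≢x₀ → trans (*-congˡ (sum-character-∤ (a +ℕ toℕ x)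
           (λ N∣a+x → x≢x₀ (∣+-unique a N∣a+x N∣a+x₀)))) (zeroʳ _)) ⟩
    h x₀ * sum (χ x₀)
      ≈⟨ *-congˡ (sum-character-∣ (a +ℕ toℕ x₀) N∣a+x₀) ⟩
    h x₀ * (N · 1#)
      ≈⟨ *-comm _ _ ⟩
    (N · 1#) * h x₀ ∎
    where
    χ : Fin N → Fin N → Carrier
    χ x y = ζ⁻ ^ ((a +ℕ toℕ x) *ℕ toℕ y)
    collect : ∀ x y → ζ⁻ ^ (a *ℕ toℕ y) * (ζ⁻ ^ (toℕ y *ℕ toℕ x) * h x) ≈ h x * χ x y
    collect x y = begin
      ζ⁻ ^ (a *ℕ toℕ y) * (ζ⁻ ^ (toℕ y *ℕ toℕ x) * h x)  ≈⟨ *-assoc _ _ _ ⟨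
      (ζ⁻ ^ (a *ℕ toℕ y) * ζ⁻ ^ (toℕ y *ℕ toℕ x)) * h x  ≈⟨ *-congʳ (^-homo-* ζ⁻ (a *ℕ toℕ y) (toℕ y *ℕ toℕ x)) ⟨
      ζ⁻ ^ (a *ℕ toℕ y +ℕ toℕ y *ℕ toℕ x) * h x          ≡⟨ cong (λ e → ζ⁻ ^ e * h x) exponent ⟩
      χ x y * h x                                         ≈⟨ *-comm _ _ ⟩
      h x * χ x y                                         ∎
      where
      exponent : a *ℕ toℕ y +ℕ toℕ y *ℕ toℕ x ≡ (a +ℕ toℕ x) *ℕ toℕ y
      exponent = ≡.trans (cong (a *ℕ toℕ y +ℕ_) (ℕ.*-comm (toℕ y) (toℕ x))) (≡.sym (ℕ.*-distribʳ-+ (toℕ y) a (toℕ x)))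

  fourier-injective : ∀ {f g} → (∀ a → fourier f a ≈ fourier g a) → ∀ y → f y ≈ g y
  fourier-injective {f} {g} f̂≈ĝ y = *-cancelˡ-≉0 isField (suc·1≉0 n) (begin
    (N · 1#) * f y                        ≈⟨ fourier² f a y N∣a+y ⟨
    fourier (λ x → fourier f (toℕ x)) a   ≈⟨ fourier-cong a (λ x → f̂≈ĝ (toℕ x)) ⟩
    fourier (λ x → fourier g (toℕ x)) a   ≈⟨ fourier² g a y N∣a+y ⟩
    (N · 1#) * g y                        ∎)
    where
    a = n *ℕ toℕ y
    N∣a+y : N ∣ a +ℕ toℕ y
    N∣a+y = subst (N ∣_) (ℕ.+-comm (toℕ y) a) (m∣m*n (toℕ y))

  fourier-subgroup : ∀ m d → m *ℕ d ≡ N → ∀ a → fourier (λ y → 𝟙[ m ∣? toℕ y ]) a ≈ 𝟙[ d ∣? a ] * (d · 1#)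
  fourier-subgroup (suc k) d md≡N a = begin
    sum {N} (λ y → ζ⁻ ^ (a *ℕ toℕ y) * 𝟙[ suc k ∣? toℕ y ])  ≈⟨ sum-cong-≋ {N} (λ y → *-comm (ζ⁻ ^ (a *ℕ toℕ y)) 𝟙[ suc k ∣? toℕ y ]) ⟩
    sum {N} (λ y → 𝟙[ suc k ∣? toℕ y ] * ζ⁻ ^ (a *ℕ toℕ y))  ≡⟨ sum≡∑ℕ N (λ y → 𝟙[ suc k ∣? y ] * ζ⁻ ^ (a *ℕ y)) ⟩
    ∑ℕ N (λ y → 𝟙[ suc k ∣? y ] * ζ⁻ ^ (a *ℕ y))         ≈⟨ subgroup-character-sum isField N ζ⁻-primitive k d md≡N a ⟩
    𝟙[ d ∣? a ] * (d · 1#)                               ∎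

  ρS≈fourier : ∀ u v x' y' →
    ρS N ζ u v (x' , y') ≈ u * fourier (λ x → fourier (λ y → v (x , y)) (toℕ x')) (toℕ y')
  ρS≈fourier u v x' y' = *-congˡ (sum-cong-≋ {N} λ x → trans (sum-cong-≋ {N} (kernel x))
    (sym (*-distribˡ-sum (ζ⁻ ^ (toℕ y' *ℕ toℕ x)) (λ y → ζ⁻ ^ (toℕ x' *ℕ toℕ y) * v (x , y)))))
    where
    kernel : ∀ x y → e- N ζ (NB N ζ (x' , y') (x , y)) * v (x , y)
                   ≈ ζ⁻ ^ (toℕ y' *ℕ toℕ x) * (ζ⁻ ^ (toℕ x' *ℕ toℕ y) * v (x , y))
    kernel x y = begin
      e- N ζ (toℕ x' *ℕ toℕ y +ℕ toℕ x *ℕ toℕ y') * v (x , y)        ≈⟨ *-congʳ (e-≈ζ⁻^ (toℕ x' *ℕ toℕ y +ℕ toℕ x *ℕ toℕ y')) ⟩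
      ζ⁻ ^ (toℕ x' *ℕ toℕ y +ℕ toℕ x *ℕ toℕ y') * v (x , y)          ≡⟨ cong (λ e → ζ⁻ ^ e * v (x , y)) exponent ⟩
      ζ⁻ ^ (toℕ y' *ℕ toℕ x +ℕ toℕ x' *ℕ toℕ y) * v (x , y)
        ≈⟨ *-congʳ (^-homo-* ζ⁻ (toℕ y' *ℕ toℕ x) (toℕ x' *ℕ toℕ y)) ⟩
      (ζ⁻ ^ (toℕ y' *ℕ toℕ x) * ζ⁻ ^ (toℕ x' *ℕ toℕ y)) * v (x , y)  ≈⟨ *-assoc _ _ _ ⟩
      ζ⁻ ^ (toℕ y' *ℕ toℕ x) * (ζ⁻ ^ (toℕ x' *ℕ toℕ y) * v (x , y))  ∎
      where
      exponent : toℕ x' *ℕ toℕ y +ℕ toℕ x *ℕ toℕ y' ≡ toℕ y' *ℕ toℕ x +ℕ toℕ x' *ℕ toℕ y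
      exponent = ≡.trans (ℕ.+-comm (toℕ x' *ℕ toℕ y) _) (cong (_+ℕ toℕ x' *ℕ toℕ y) (ℕ.*-comm (toℕ x) (toℕ y')))

  vH-factor : ∀ d .{{_ : NonZero d}} x y → vH N d (x , y) ≈ 𝟙[ d ∣? toℕ x ] * 𝟙[ N / d ∣? toℕ y ]
  vH-factor d x y = 𝟙-∧ (d ∣? toℕ x) (N / d ∣? toℕ y)

  fourier-vH : ∀ k → suc k ∣ N → ∀ x a →
    fourier (λ y → vH N (suc k) (x , y)) a ≈ 𝟙[ suc k ∣? toℕ x ] * (𝟙[ suc k ∣? a ] * (suc k · 1#))
  fourier-vH k d∣N x a = begin
    fourier (λ y → vH N d (x , y)) a                          ≈⟨ fourier-cong a (vH-factor d x) ⟩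
    fourier (λ y → 𝟙[ d ∣? toℕ x ] * 𝟙[ N / d ∣? toℕ y ]) a   ≈⟨ fourier-* 𝟙[ d ∣? toℕ x ] (λ y → 𝟙[ N / d ∣? toℕ y ]) a ⟩
    𝟙[ d ∣? toℕ x ] * fourier (λ y → 𝟙[ N / d ∣? toℕ y ]) a   ≈⟨ *-congˡ (fourier-subgroup (N / d) d (m/n*n≡m d∣N) a) ⟩
    𝟙[ d ∣? toℕ x ] * (𝟙[ d ∣? a ] * (d · 1#))               ∎
    where d = suc k

  module _ (k : ℕ) (d∣N : suc k ∣ N) where
    private
      d m : ℕ
      d = suc k
      m = N / d
      dm≡N : d *ℕ m ≡ N
      dm≡N = m*[n/m]≡n d∣N

    -- H_d is isotropic: d ∣ x and m ∣ y give N ∣ x y.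
    vH-T-invariant : ∀ γ → ρT N ζ (vH N d) γ ≈ vH N d γ
    vH-T-invariant (x , y) =
      trans (*-congˡ (vH-factor d x y)) (trans (on-support (d ∣? toℕ x) (m ∣? toℕ y)) (sym (vH-factor d x y)))
      where
      on-support : (p : Dec (d ∣ toℕ x)) (q : Dec (m ∣ toℕ y)) →
                   e+ N ζ (toℕ x *ℕ toℕ y) * (𝟙[ p ] * 𝟙[ q ]) ≈ 𝟙[ p ] * 𝟙[ q ]
      on-support (yes d∣x) (yes m∣y) = trans (*-congʳ (reflexive (cong (ζ ^_) xy%N≡0))) (*-identityˡ _)
        where
        xy%N≡0 : (toℕ x *ℕ toℕ y) % N ≡ 0
        xy%N≡0 = n∣m⇒m%n≡0 _ N (subst (_∣ toℕ x *ℕ toℕ y) dm≡N (*-pres-∣ d∣x m∣y))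
      on-support (yes _) (no _) = trans (*-congˡ (zeroʳ _)) (trans (zeroʳ _) (sym (zeroʳ _)))
      on-support (no _) _ = trans (*-congˡ (zeroˡ _)) (trans (zeroʳ _) (sym (zeroˡ _)))

    vH-S-invariant : ∀ u → (N · 1#) * u ≈ 1# → ∀ β → ρS N ζ u (vH N d) β ≈ vH N d β
    vH-S-invariant u Nu≈1 (x' , y') = begin
      ρS N ζ u (vH N d) (x' , y')
        ≈⟨ ρS≈fourier u (vH N d) x' y' ⟩
      u * fourier (λ x → fourier (λ y → vH N d (x , y)) (toℕ x')) (toℕ y')
        ≈⟨ *-congˡ (fourier-cong (toℕ y') (λ x → trans (fourier-vH k d∣N x (toℕ x')) (*-comm _ C))) ⟩
      u * fourier (λ x → C * 𝟙[ d ∣? toℕ x ]) (toℕ y')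
        ≈⟨ *-congˡ (fourier-* C (λ x → 𝟙[ d ∣? toℕ x ]) (toℕ y')) ⟩
      u * (C * fourier (λ x → 𝟙[ d ∣? toℕ x ]) (toℕ y'))
        ≈⟨ *-congˡ (*-congˡ (fourier-subgroup d m dm≡N (toℕ y'))) ⟩
      u * ((𝟙[ d ∣? toℕ x' ] * (d · 1#)) * (𝟙[ m ∣? toℕ y' ] * (m · 1#)))
        ≈⟨ *-congˡ (interchange _ _ _ _) ⟩
      u * ((𝟙[ d ∣? toℕ x' ] * 𝟙[ m ∣? toℕ y' ]) * ((d · 1#) * (m · 1#)))
        ≈⟨ x∙yz≈y∙zx u _ _ ⟩
      (𝟙[ d ∣? toℕ x' ] * 𝟙[ m ∣? toℕ y' ]) * (((d · 1#) * (m · 1#)) * u)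
        ≈⟨ *-congˡ (*-congʳ (trans (sym (×1-homo-* d m)) (reflexive (cong (_· 1#) dm≡N)))) ⟩
      (𝟙[ d ∣? toℕ x' ] * 𝟙[ m ∣? toℕ y' ]) * ((N · 1#) * u)
        ≈⟨ trans (*-congˡ Nu≈1) (*-identityʳ _) ⟩
      𝟙[ d ∣? toℕ x' ] * 𝟙[ m ∣? toℕ y' ]
        ≈⟨ vH-factor d x' y' ⟨
      vH N d (x' , y') ∎
      where
      C = 𝟙[ d ∣? toℕ x' ] * (d · 1#)

  vH-at-divisor-point : ∀ (k k' : Fin N) → suc (toℕ k) ∣ N → suc (toℕ k') ∣ N →
    vH N (suc (toℕ k')) (suc (toℕ k) mod N , (N / suc (toℕ k)) mod N) ≈ 𝟙[ k' ≟ k ]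
  vH-at-divisor-point k k' d∣N d'∣N = begin
    vH N d' (d mod N , m mod N)                               ≈⟨ vH-factor d' (d mod N) (m mod N) ⟩
    𝟙[ d' ∣? toℕ (d mod N) ] * 𝟙[ m' ∣? toℕ (m mod N) ]
      ≈⟨ *-cong (𝟙-cong (d' ∣? toℕ (d mod N)) (d' ∣? d) (∣-mod⇔ d d'∣N))
                (𝟙-cong (m' ∣? toℕ (m mod N)) (m' ∣? m) (∣-mod⇔ m (m/n∣m d'∣N))) ⟩
    𝟙[ d' ∣? d ] * 𝟙[ m' ∣? m ]                               ≈⟨ compare (k' ≟ k) (d' ∣? d) (m' ∣? m) ⟩
    𝟙[ k' ≟ k ]                                               ∎
    where
    d d' m m' : ℕ
    d = suc (toℕ k)
    d' = suc (toℕ k')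
    m = N / d
    m' = N / d'
    compare : (e : Dec (k' ≡ k)) (p : Dec (d' ∣ d)) (q : Dec (m' ∣ m)) → 𝟙[ p ] * 𝟙[ q ] ≈ 𝟙[ e ]
    compare (yes ≡.refl) p q = trans (*-cong (𝟙-yes p ∣-refl) (𝟙-yes q ∣-refl)) (*-identityˡ 1#)
    compare (no k'≢k) (yes d'∣d) (yes m'∣m) =
      contradiction (Finₚ.toℕ-injective (ℕ.suc-injective (cofactor-∣⇒≡ d∣N d'∣N d'∣d m'∣m))) k'≢k
    compare (no _) (yes _) (no _) = zeroʳ _
    compare (no _) (no _) _ = zeroˡ _

  vH-independent : ∀ (cf : Fin N → Carrier) → (∀ γ → lincomb N cf γ ≈ 0#) → ∀ k → suc (toℕ k) ∣ N → cf k ≈ 0#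
  vH-independent cf lincomb≈0 k d∣N = trans (sym lincomb-at-point) (lincomb≈0 point)
    where
    point : D N
    point = (suc (toℕ k) mod N , (N / suc (toℕ k)) mod N)
    term : Fin N → Carrier
    term k' = 𝟙[ suc (toℕ k') ∣? N ] * (cf k' * 𝟙[ k' ≟ k ])
    lincomb-at-point : lincomb N cf point ≈ cf k
    lincomb-at-point = begin
      lincomb N cf point
        ≈⟨ sum-cong-≋ {N} (λ k' → trans (if-else-0 (suc (toℕ k') ∣? N) (cf k' * vH N (suc (toℕ k')) point))
             (𝟙-*-cong (suc (toℕ k') ∣? N) (λ d'∣N → *-congˡ (vH-at-divisor-point k k' d∣N d'∣N)))) ⟩
      sum term
        ≈⟨ sum-single term k (λ k' k'≢k → trans (*-congˡ (trans (*-congˡ (𝟙-no (k' ≟ k) k'≢k)) (zeroʳ _))) (zeroʳ _)) ⟩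
      term k
        ≈⟨ *-cong (𝟙-yes (suc (toℕ k) ∣? N) d∣N) (*-congˡ (𝟙-yes (k ≟ k) ≡.refl)) ⟩
      1# * (cf k * 1#)
        ≈⟨ trans (*-identityˡ _) (*-identityʳ _) ⟩
      cf k ∎

  fourier-lincomb : ∀ (cf : Fin N → Carrier) x a →
    fourier (λ y → lincomb N cf (x , y)) a
      ≈ sum (λ k → divisor-weight k (gcd (gcd (toℕ x) a) N) * (cf k * (suc (toℕ k) · 1#)))
  fourier-lincomb cf x a = trans (fourier-sum term a) (sum-cong-≋ {N} transform-term)
    where
    g : ℕ
    g = gcd (gcd (toℕ x) a) N
    term : Fin N → Fin N → Carrier
    term k y = if does (suc (toℕ k) ∣? N) then cf k * vH N (suc (toℕ k)) (x , y) else 0#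
    transform-term : ∀ k → fourier (term k) a ≈ divisor-weight k g * (cf k * (suc (toℕ k) · 1#))
    transform-term k = begin
      fourier (term k) a
        ≈⟨ fourier-cong a (λ y → if-else-0 (d ∣? N) (cf k * vH N d (x , y))) ⟩
      fourier (λ y → 𝟙[ d ∣? N ] * (cf k * vH N d (x , y))) a
        ≈⟨ fourier-* 𝟙[ d ∣? N ] (λ y → cf k * vH N d (x , y)) a ⟩
      𝟙[ d ∣? N ] * fourier (λ y → cf k * vH N d (x , y)) a
        ≈⟨ 𝟙-*-cong (d ∣? N) (λ d∣N → trans (fourier-* (cf k) (λ y → vH N d (x , y)) a)
                                             (*-congˡ (fourier-vH (toℕ k) d∣N x a))) ⟩
      𝟙[ d ∣? N ] * (cf k * (𝟙[ d ∣? toℕ x ] * (𝟙[ d ∣? a ] * (d · 1#))))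
        ≈⟨ *-congˡ (trans (*-congˡ (sym (*-assoc _ _ _))) (x∙yz≈y∙xz (cf k) _ _)) ⟩
      𝟙[ d ∣? N ] * ((𝟙[ d ∣? toℕ x ] * 𝟙[ d ∣? a ]) * (cf k * (d · 1#)))
        ≈⟨ 𝟙-*-cong (d ∣? N) (λ d∣N → *-congʳ (trans (𝟙-∣-gcd d (toℕ x) a) (𝟙-cong (d ∣? gcd (toℕ x) a) (d ∣? g)
             (mk⇔ (λ d∣g' → gcd-greatest d∣g' d∣N) (λ d∣g → ∣-trans d∣g (gcd[m,n]∣m _ N)))))) ⟩
      𝟙[ d ∣? N ] * (𝟙[ d ∣? g ] * (cf k * (d · 1#)))
        ≈⟨ *-assoc _ _ _ ⟨
      divisor-weight k g * (cf k * (d · 1#)) ∎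
      where
      d = suc (toℕ k)

  module Spanning (v : Vect N) (T-inv : ∀ γ → ρT N ζ v γ ≈ v γ)
                  (S-inv : ∀ u → (N · 1#) * u ≈ 1# → ∀ β → ρS N ζ u v β ≈ v β) where

    ŵ : Fin N → ℕ → Carrier
    ŵ x = fourier (λ y → v (x , y))

    ŵ-≡ₘ : ∀ x {a b} → a ≡ₘ b → ŵ x a ≈ ŵ x b
    ŵ-≡ₘ x = fourier-≡ₘ (λ y → v (x , y))

    ŵ-shift : ∀ x a → ŵ x (a +ℕ toℕ x) ≈ ŵ x a
    ŵ-shift x a = fourier-shift (λ y → v (x , y)) a (toℕ x) untwist
      where
      untwist : ∀ y → ζ⁻ ^ (toℕ x *ℕ toℕ y) * v (x , y) ≈ v (x , y)
      untwist y = begin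
        ζ⁻ ^ j * v (x , y)             ≈⟨ *-congˡ (trans (*-congʳ (sym (e+≈ζ^ j))) (T-inv (x , y))) ⟨
        ζ⁻ ^ j * (ζ ^ j * v (x , y))   ≈⟨ *-assoc _ _ _ ⟨
        (ζ⁻ ^ j * ζ ^ j) * v (x , y)   ≈⟨ *-congʳ (trans (*-comm _ _) (ζ^*ζ⁻^≈1 j)) ⟩
        1# * v (x , y)                 ≈⟨ *-identityˡ _ ⟩
        v (x , y)                      ∎
        where j = toℕ x *ℕ toℕ y

    ŵ-rotate : ∀ x' x₀ a → N ∣ a +ℕ toℕ x₀ → ŵ x' a ≈ ŵ x₀ (toℕ x')
    ŵ-rotate x' x₀ a N∣a+x₀ = begin
      fourier (λ y' → v (x' , y')) a
        ≈⟨ fourier-cong a (λ y' → trans (sym (S-inv N⁻¹ (*-1/suc n) (x' , y'))) (ρS≈fourier N⁻¹ v x' y')) ⟩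
      fourier (λ y' → N⁻¹ * fourier (λ x → ŵ x (toℕ x')) (toℕ y')) a
        ≈⟨ fourier-* N⁻¹ (λ y' → fourier (λ x → ŵ x (toℕ x')) (toℕ y')) a ⟩
      N⁻¹ * fourier (λ y' → fourier (λ x → ŵ x (toℕ x')) (toℕ y')) a
        ≈⟨ *-congˡ (fourier² (λ x → ŵ x (toℕ x')) a x₀ N∣a+x₀) ⟩
      N⁻¹ * ((N · 1#) * ŵ x₀ (toℕ x'))
        ≈⟨ trans (sym (*-assoc _ _ _)) (trans (*-congʳ (trans (*-comm _ _) (*-1/suc n))) (*-identityˡ _)) ⟩
      ŵ x₀ (toℕ x') ∎
      where N⁻¹ = 1/suc n

    -- ŵ with both coordinates in ℕ, so that the moves below are plain arithmetic
    W : ℕ → ℕ → Carrier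
    W p q = ŵ (p mod N) q

    W-cong : ∀ {p p' q q'} → p ≡ₘ p' → q ≡ₘ q' → W p q ≈ W p' q'
    W-cong {p' = p'} {q = q} p≡p' q≡q' =
      trans (reflexive (cong (λ x → ŵ x q) (mod-cong p≡p'))) (ŵ-≡ₘ (p' mod N) q≡q')

    W-shearʳ : ∀ k p q → W p q ≈ W p (q +ℕ k *ℕ p)
    W-shearʳ zero p q = W-cong (≡ₘ-refl {p}) (≡⇒≡ₘ (≡.sym (ℕ.+-identityʳ q)))
    W-shearʳ (suc k) p q = begin
      W p q                                        ≈⟨ W-shearʳ k p q ⟩
      W p (q +ℕ k *ℕ p)                            ≈⟨ ŵ-shift (p mod N) (q +ℕ k *ℕ p) ⟨
      ŵ (p mod N) (q +ℕ k *ℕ p +ℕ toℕ (p mod N))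
        ≈⟨ ŵ-≡ₘ (p mod N) (≡ₘ-trans (+-congₘ (≡ₘ-refl {q +ℕ k *ℕ p}) (toℕ-mod-≡ₘ p)) (≡⇒≡ₘ regroup)) ⟩
      W p (q +ℕ suc k *ℕ p)                        ∎
      where
      regroup : q +ℕ k *ℕ p +ℕ p ≡ q +ℕ suc k *ℕ p
      regroup = ≡.trans (ℕ.+-assoc q (k *ℕ p) p) (cong (q +ℕ_) (ℕ.+-comm (k *ℕ p) p))

    W-rotate : ∀ p q r → N ∣ q +ℕ r → W p q ≈ W r p
    W-rotate p q r N∣q+r = trans (ŵ-rotate (p mod N) (r mod N) q N∣q+r') (ŵ-≡ₘ (r mod N) (toℕ-mod-≡ₘ p))
      where
      N∣q+r' : N ∣ q +ℕ toℕ (r mod N)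
      N∣q+r' = ≡ₘ0⇒∣ (≡ₘ-trans (+-congₘ (≡ₘ-refl {q}) (toℕ-mod-≡ₘ r)) (∣⇒≡ₘ0 N∣q+r))

    -- W-shearʳ conjugated by the rotation
    W-shearˡ : ∀ k p q → W (p +ℕ k *ℕ q) q ≈ W p q
    W-shearˡ k p q = begin
      W (p +ℕ k *ℕ q) q                ≈⟨ W-rotate (p +ℕ k *ℕ q) q r N∣q+r ⟩
      W r (p +ℕ k *ℕ q)                ≈⟨ W-shearʳ k r (p +ℕ k *ℕ q) ⟩
      W r (p +ℕ k *ℕ q +ℕ k *ℕ r)      ≈⟨ W-cong (≡ₘ-refl {r}) collapse ⟩
      W r p                            ≈⟨ W-rotate p q r N∣q+r ⟨
      W p q                            ∎
      where
      r = n *ℕ q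
      N∣q+r : N ∣ q +ℕ r
      N∣q+r = m∣m*n q
      collapse : p +ℕ k *ℕ q +ℕ k *ℕ r ≡ₘ p
      collapse = ≡ₘ-trans (≡⇒≡ₘ (≡.trans (ℕ.+-assoc p (k *ℕ q) (k *ℕ r)) (cong (p +ℕ_) (≡.sym (ℕ.*-distribˡ-+ k q r)))))
                   (≡ₘ-trans (+-congₘ (≡ₘ-refl {p}) (∣⇒≡ₘ0 (∣n⇒∣m*n k N∣q+r))) (≡⇒≡ₘ (ℕ.+-identityʳ p)))

    W-zero-swap : ∀ b → W 0 b ≈ W b 0
    W-zero-swap b = begin
      W 0 b                  ≈⟨ W-shearˡ 1 0 b ⟨
      W (0 +ℕ 1 *ℕ b) b      ≈⟨ W-cong (≡⇒≡ₘ (ℕ.+-identityʳ b)) (≡ₘ-refl {b}) ⟩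
      W b b                  ≈⟨ W-shearʳ n b b ⟩
      W b (b +ℕ n *ℕ b)      ≈⟨ W-cong (≡ₘ-refl {b}) (∣⇒≡ₘ0 (m∣m*n b)) ⟩
      W b 0                  ∎

    -- Euclid's algorithm, performed by the shears
    W-gcd : ∀ b → Acc _<_ b → ∀ a → W a b ≈ W (gcd a b) 0
    W-gcd zero _ a = W-cong (≡⇒≡ₘ (≡.sym (gcd-identityʳ a))) (≡ₘ-refl {0})
    W-gcd b@(suc _) (acc rec) a = begin
      W a b                          ≈⟨ W-cong (≡⇒≡ₘ (m≡m%n+[m/n]*n a b)) (≡ₘ-refl {b}) ⟩
      W (a % b +ℕ (a / b) *ℕ b) b    ≈⟨ W-shearˡ (a / b) (a % b) b ⟩
      W (a % b) b                    ≈⟨ reduce (a % b) (m%n<n a b) ⟩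
      W (gcd (a % b) b) 0            ≡⟨ cong (λ g → W g 0) (gcd[m%n,n]≡gcd[m,n] a b) ⟩
      W (gcd a b) 0                  ∎
      where
      reduce : ∀ r → r < b → W r b ≈ W (gcd r b) 0
      reduce zero _ = trans (W-zero-swap b) (W-cong (≡⇒≡ₘ (≡.sym (gcd-identityˡ b))) (≡ₘ-refl {0}))
      reduce r@(suc _) r<b = begin
        W r b                          ≈⟨ W-cong (≡ₘ-refl {r}) (≡⇒≡ₘ (m≡m%n+[m/n]*n b r)) ⟩
        W r (b % r +ℕ (b / r) *ℕ r)    ≈⟨ W-shearʳ (b / r) r (b % r) ⟨
        W r (b % r)                    ≈⟨ W-gcd (b % r) (rec (ℕ.<-trans (m%n<n b r) r<b)) r ⟩
        W (gcd r (b % r)) 0            ≡⟨ cong (λ g → W g 0) gcd-step ⟩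
        W (gcd r b) 0                  ∎
        where
        gcd-step : gcd r (b % r) ≡ gcd r b
        gcd-step = ≡.trans (gcd-comm r (b % r)) (≡.trans (gcd[m%n,n]≡gcd[m,n] b r) (gcd-comm b r))

    ŵ-gcd : ∀ x a → ŵ x a ≈ W (gcd (gcd (toℕ x) a) N) 0
    ŵ-gcd x a = begin
      ŵ x a             ≡⟨ cong (λ x → ŵ x a) (mod-toℕ x) ⟨
      W (toℕ x) a       ≈⟨ W-gcd a (<-wellFounded a) (toℕ x) ⟩
      W g 0             ≈⟨ W-cong (≡ₘ-refl {g}) (≡ₘ-sym (∣⇒≡ₘ0 ∣-refl)) ⟩
      W g N             ≈⟨ W-gcd N (<-wellFounded N) g ⟩
      W (gcd g N) 0     ∎
      where g = gcd (toℕ x) a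

    in-span : ∃ λ (cf : Fin N → Carrier) → ∀ γ → v γ ≈ lincomb N cf γ
    in-span = cf , λ (x , y) → fourier-injective {λ y → v (x , y)} {λ y → lincomb N cf (x , y)} (same-transform x) y
      where
      c : Fin N → Carrier
      c = proj₁ (divisor-sum-surjective (λ g → W g 0))
      -- the transform of v^{H_d} carries a factor d
      cf : Fin N → Carrier
      cf k = c k * 1/suc (toℕ k)
      cf-scaled : ∀ k → cf k * (suc (toℕ k) · 1#) ≈ c k
      cf-scaled k = trans (*-assoc _ _ _) (trans (*-congˡ (trans (*-comm _ _) (*-1/suc (toℕ k)))) (*-identityʳ _))
      same-transform : ∀ x a → ŵ x a ≈ fourier (λ y → lincomb N cf (x , y)) a
      same-transform x a = begin
        ŵ x a                   ≈⟨ ŵ-gcd x a ⟩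
        W g 0                   ≈⟨ proj₂ (divisor-sum-surjective (λ g → W g 0)) g (gcd[m,n]∣n (gcd (toℕ x) a) N) ⟩
        divisor-sum c g         ≈⟨ sum-cong-≋ {N} (λ k → *-congˡ {divisor-weight k g} (cf-scaled k)) ⟨
        sum (λ k → divisor-weight k g * (cf k * (suc (toℕ k) · 1#)))  ≈⟨ fourier-lincomb cf x a ⟨
        fourier (λ y → lincomb N cf (x , y)) a ∎
        where g = gcd (gcd (toℕ x) a) N

  invariant-in-span : ∀ v → Invariant N ζ v → ∃ λ (cf : Fin N → Carrier) → ∀ γ → v γ ≈ lincomb N cf γ
  invariant-in-span v (T-inv , S-inv) = Spanning.in-span v T-inv S-inv

corollary4p2 : ∀ {c ℓ} (R : CommutativeRing c ℓ) →
    let open CommutativeRing R in let open Weil R in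
    IsField → CharZero →
    (N : ℕ) .{{_ : NonZero N}} (ζ : Carrier) → PrimitiveRoot N ζ →
    ((k : Fin N) → suc (toℕ k) ∣ N → Invariant N ζ (vH N (suc (toℕ k))))
    × ((cf : Fin N → Carrier) → (∀ γ → lincomb N cf γ ≈ 0#) →
         (k : Fin N) → suc (toℕ k) ∣ N → cf k ≈ 0#)
    × ((v : Vect N) → Invariant N ζ v → ∃ λ (cf : Fin N → Carrier) → ∀ γ → v γ ≈ lincomb N cf γ)
corollary4p2 R isField charZero (suc n) ζ prim =
    (λ k d∣N → vH-T-invariant (toℕ k) d∣N , vH-S-invariant (toℕ k) d∣N)
  , vH-independent
  , invariant-in-span
  where open WeilInvariants R isField charZero n ζ prim
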